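{- Let $\mathtt{X}\in\{\mathtt{FT},\mathtt{R},\mathtt{F}\}$, with $\mathcal{E}_{\mathtt{FT}}=\mathcal{E}_1\cup\{\mathrm{FT},\mathrm{RS},\mathrm{FP},\mathrm{EL2}\}$, $\mathcal{E}_{\mathtt{R}}=\mathcal{E}_1\cup\{\mathrm{R},\mathrm{FP},\mathrm{EL2}\}$ and $\mathcal{E}_{\mathtt{F}}=\mathcal{E}_1\cup\{\mathrm{F},\mathrm{R},\mathrm{FP},\mathrm{EL2}\}$. For every $\mathrm{BCCSP}_{\|}$ term $p$ there is a closed BCCSP term $q$ (one with no occurrence of $\|$) such that $\mathcal{E}_{\mathtt{X}}\vdash p\approx q$.
   Context: Let $\mathcal{A}$ be a finite non-empty set of actions and $\mathcal{V}$ a countably infinite set of variables. $\mathrm{BCCSP}_{\|}$ terms: $t ::= \mathbf{0} \mid x \mid a.t \mid t+t \mid t \,\|\, t$ ($a\in\mathcal{A}$, $x \in \mathcal{V}$; $ax$ means $a.x$); BCCSP terms are those without $\|$; closed terms contain no variables. $\mathcal{E}\vdash t\approx u$: derivable in equational logic (reflexivity, symmetry, transitivity, substitution instances of axioms, closure under $a.\_$, $+$, $\|$). Axioms with concrete action names stand for all instances with actions from $\mathcal{A}$; $\sum$ over an empty set is $\mathbf{0}$. $\mathcal{E}_1$: A0 $x+\mathbf{0}\approx x$; A1 $x+y\approx y+x$; A2 $(x+y)+z \approx x+(y+z)$; A3 $x+x\approx x$; P0 $x\|\mathbf{0}\approx x$; P1 $x\|y \approx y \| x$. FT: $ax+ay\approx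 ax+ay+a(x+y)$. RS: $a(bx+by+z)\approx a(bx+by+z)+a(bx+z)$. R: $a(bx+z)+a(by+w)\approx a(bx+by+z)+a(by+w)$. F: $ax+a(y+z)\approx ax+a(x+y)+a(y+z)$. FP: $(ax+ay+w)\|z\approx(ax+w)\|z+(ay+w)\|z$. EL2: $\sum_{i\in I} a_ix_i \| \sum_{j\in J} b_jy_j \approx \sum_{i\in I} a_i(x_i \| \sum_{j\in J} b_j y_j) + \sum_{j\in J} b_j(\sum_{i\in I} a_i x_i \| y_j)$ for finite $I,J$ with the $a_i$ pairwise distinct and the $b_j$ pairwise distinct. -}

module Defs where

open import Data.Nat using (ℕ; suc)
open import Data.Fin using (Fin)
open import Data.List using (List; []; _∷_; map)
open import Data.Product using (_×_; _,_; proj₁)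
open import Data.List.Relation.Unary.Unique.Propositional using (Unique)

infixr 7 _∙_
infixl 5 _⊕_
infixl 6 _∥_

data Term (A : Set) : Set where
  𝟎   : Term A
  var : ℕ → Term A
  _∙_ : A → Term A → Term A
  _⊕_ : Term A → Term A → Term A
  _∥_ : Term A → Term A → Term A

data Closed {A : Set} : Term A → Set where
  𝟎c : Closed 𝟎
  ∙c : ∀ {a t} → Closed t → Closed (a ∙ t)
  ⊕c : ∀ {t u} → Closed t → Closed u → Closed (t ⊕ u)
  ∥c : ∀ {t u} → Closed t → Closed u → Closed (t ∥ u)

data BCCSP {A : Set} : Term A → Set where
  𝟎b   : BCCSP 𝟎
  varb : ∀ {x} → BCCSP (var x)
  ∙b   : ∀ {a t} → BCCSP t → BCCSP (a ∙ t)
  ⊕b   : ∀ {t u} → BCCSP t → BCCSP u → BCCSP (t ⊕ u)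

EqSet : Set → Set₁
EqSet A = Term A → Term A → Set

Σ⊕ : {A : Set} → List (Term A) → Term A
Σ⊕ []           = 𝟎
Σ⊕ (t ∷ [])     = t
Σ⊕ (t ∷ u ∷ ts) = t ⊕ Σ⊕ (u ∷ ts)

Σpre : {A : Set} → List (A × Term A) → Term A
Σpre ps = Σ⊕ (map (λ { (a , t) → a ∙ t }) ps)

Σpre∥ʳ : {A : Set} → List (A × Term A) → Term A → Term A
Σpre∥ʳ ps r = Σ⊕ (map (λ { (a , t) → a ∙ (t ∥ r) }) ps)

Σpre∥ˡ : {A : Set} → Term A → List (A × Term A) → Term A
Σpre∥ˡ r qs = Σ⊕ (map (λ { (b , t) → b ∙ (r ∥ t) }) qs)

-- Axiom schemas, given directly as the sets of all their substitution instances
-- (metavariables range over arbitrary terms, actions over A).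
data E₁ {A : Set} : EqSet A where
  A0 : ∀ x → E₁ (x ⊕ 𝟎) x
  A1 : ∀ x y → E₁ (x ⊕ y) (y ⊕ x)
  A2 : ∀ x y z → E₁ ((x ⊕ y) ⊕ z) (x ⊕ (y ⊕ z))
  A3 : ∀ x → E₁ (x ⊕ x) x
  P0 : ∀ x → E₁ (x ∥ 𝟎) x
  P1 : ∀ x y → E₁ (x ∥ y) (y ∥ x)

data FTax {A : Set} : EqSet A where
  ft : ∀ (a : A) x y → FTax (a ∙ x ⊕ a ∙ y) (a ∙ x ⊕ a ∙ y ⊕ a ∙ (x ⊕ y))

data RSax {A : Set} : EqSet A where
  rs : ∀ (a b : A) x y z →
       RSax (a ∙ (b ∙ x ⊕ b ∙ y ⊕ z)) (a ∙ (b ∙ x ⊕ b ∙ y ⊕ z) ⊕ a ∙ (b ∙ x ⊕ z))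

data Rax {A : Set} : EqSet A where
  r : ∀ (a b : A) x y z w →
      Rax (a ∙ (b ∙ x ⊕ z) ⊕ a ∙ (b ∙ y ⊕ w)) (a ∙ (b ∙ x ⊕ b ∙ y ⊕ z) ⊕ a ∙ (b ∙ y ⊕ w))

data Fax {A : Set} : EqSet A where
  f : ∀ (a : A) x y z →
      Fax (a ∙ x ⊕ a ∙ (y ⊕ z)) (a ∙ x ⊕ a ∙ (x ⊕ y) ⊕ a ∙ (y ⊕ z))

data FPax {A : Set} : EqSet A where
  fp : ∀ (a : A) x y w z →
       FPax ((a ∙ x ⊕ a ∙ y ⊕ w) ∥ z) ((a ∙ x ⊕ w) ∥ z ⊕ (a ∙ y ⊕ w) ∥ z)

data EL2ax {A : Set} : EqSet A where
  el2 : ∀ (ps qs : List (A × Term A)) →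
        Unique (map proj₁ ps) → Unique (map proj₁ qs) →
        EL2ax (Σpre ps ∥ Σpre qs) (Σpre∥ʳ ps (Σpre qs) ⊕ Σpre∥ˡ (Σpre ps) qs)

data Variant : Set where
  vFT vR vF : Variant

data 𝓔 {A : Set} : Variant → EqSet A where
  e1  : ∀ {X t u} → E₁ t u → 𝓔 X t u
  fpX : ∀ {X t u} → FPax t u → 𝓔 X t u
  elX : ∀ {X t u} → EL2ax t u → 𝓔 X t u
  ftFT : ∀ {t u} → FTax t u → 𝓔 vFT t u
  rsFT : ∀ {t u} → RSax t u → 𝓔 vFT t u
  rR   : ∀ {t u} → Rax t u → 𝓔 vR t u
  fF   : ∀ {t u} → Fax t u → 𝓔 vF t u
  rF   : ∀ {t u} → Rax t u → 𝓔 vF t u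

-- equational logic derivability (axiom rule admits all substitution instances,
-- since the axiom sets above are already closed under substitution)
infix 4 _⊢_≈_
data _⊢_≈_ {A : Set} (E : EqSet A) : Term A → Term A → Set where
  ax    : ∀ {t u} → E t u → E ⊢ t ≈ u
  refl  : ∀ {t} → E ⊢ t ≈ t
  sym   : ∀ {t u} → E ⊢ t ≈ u → E ⊢ u ≈ t
  trans : ∀ {t u v} → E ⊢ t ≈ u → E ⊢ u ≈ v → E ⊢ t ≈ v
  cong∙ : ∀ {a t u} → E ⊢ t ≈ u → E ⊢ a ∙ t ≈ a ∙ u
  cong⊕ : ∀ {t t' u u'} → E ⊢ t ≈ t' → E ⊢ u ≈ u' → E ⊢ t ⊕ u ≈ t' ⊕ u'
  cong∥ : ∀ {t t' u u'} → E ⊢ t ≈ t' → E ⊢ u ≈ u' → E ⊢ t ∥ u ≈ t' ∥ u'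

Act : ℕ → Set
Act n = Fin (suc n)

{-# OPTIONS --safe #-}
-- Closed BCCSP terms are finitely branching trees, i.e. sums of prefixed trees.
-- The parallel composition of two such sums is eliminated by recursion on their
-- weights: while one side offers some action twice, FP splits the composition into
-- two in which that side has one summand fewer; once both sides offer pairwise
-- distinct actions, EL2 expands it into prefixed parallel compositions of smaller trees.
module Submission where

open import Defs
open import Data.Nat using (ℕ; zero; suc; _+_; _≤_; _<_; s≤s; s≤s⁻¹; z<s)
open import Data.Nat.Properties
  using (<-trans; <-≤-trans; ≤-refl; m<n+m; m≤m+n; +-monoʳ-<; +-commutativeSemigroup)
open import Algebra.Properties.CommutativeSemigroup +-commutativeSemigroup using (x∙yz≈y∙xz)
import Data.Fin.Properties as Fin
open import Data.Product using (Σ; Σ-syntax; _×_; _,_; proj₁; map₂)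
open import Function using (_∘_)
open import Data.Sum using (_⊎_; inj₁; inj₂)
open import Data.List using (List; []; _∷_; map; _++_)
open import Data.List.Properties using (map-∘)
open import Data.List.Membership.Propositional using (_∈_)
open import Data.List.Membership.Propositional.Properties using (∈-map⁻; ∈-∃++)
open import Data.List.Relation.Unary.Any using (here; there)
open import Data.List.Relation.Unary.All.Properties using (¬Any⇒All¬)
open import Data.List.Relation.Unary.AllPairs using (_∷_)
open import Data.List.Relation.Unary.Unique.Propositional using (Unique; [])
open import Data.List.Relation.Binary.Permutation.Propositional using (_↭_; refl; prep; swap; trans; ↭-sym)
open import Data.List.Relation.Binary.Permutation.Propositional.Properties using (shift)
open import Relation.Binary using (Setoid; DecidableEquality; _⇒_)
open import Relation.Nullary using (yes; no)
open import Relation.Binary.PropositionalEquality as ≡ using (_≡_)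

module Duplicates {A B : Set} (_≟_ : DecidableEquality A) where
  open import Data.List.Membership.DecPropositional _≟_ using (_∈?_)

  data HasDuplicateKey (ps : List (A × B)) : Set where
    duplicate : ∀ a x y rest → ps ↭ (a , x) ∷ (a , y) ∷ rest → HasDuplicateKey ps

  ∈⇒↭∷ : ∀ {p} {ps : List (A × B)} → p ∈ ps → Σ[ rest ∈ List (A × B) ] ps ↭ p ∷ rest
  ∈⇒↭∷ {p} p∈ps with ys , zs , ≡.refl ← ∈-∃++ p∈ps = ys ++ zs , shift p ys zs

  uniqueKeys⊎duplicateKey : ∀ ps → Unique (map proj₁ ps) ⊎ HasDuplicateKey ps
  uniqueKeys⊎duplicateKey [] = inj₁ []
  uniqueKeys⊎duplicateKey ((a , x) ∷ ps) with a ∈? map proj₁ ps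
  ... | yes a∈ps with (a , y) , p∈ps , ≡.refl ← ∈-map⁻ proj₁ a∈ps
                 with rest , ps↭ ← ∈⇒↭∷ p∈ps
    = inj₂ (duplicate a x y rest (prep (a , x) ps↭))
  ... | no a∉ps with uniqueKeys⊎duplicateKey ps
  ...   | inj₁ unique = inj₁ (¬Any⇒All¬ _ a∉ps ∷ unique)
  ...   | inj₂ (duplicate b u v rest ps↭) =
    inj₂ (duplicate b u v ((a , x) ∷ rest)
      (trans (prep (a , x) ps↭) (↭-sym (shift (a , x) ((b , u) ∷ (b , v) ∷ []) rest))))

module Trees {A : Set} where

  data Tree : Set where
    node : List (A × Tree) → Tree

  Forest : Set
  Forest = List (A × Tree)

  mutual
    ⟦_⟧ : Tree → Term A
    ⟦ node ps ⟧ = ⟦ ps ⟧ᶠ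

    ⟦_⟧ᶠ : Forest → Term A
    ⟦ [] ⟧ᶠ = 𝟎
    ⟦ (a , t) ∷ ps ⟧ᶠ = a ∙ ⟦ t ⟧ ⊕ ⟦ ps ⟧ᶠ

  mutual
    size : Tree → ℕ
    size (node ps) = weight ps

    weight : Forest → ℕ
    weight [] = 0
    weight ((a , t) ∷ ps) = suc (size t) + weight ps

  mutual
    ⟦⟧-closed : ∀ t → Closed ⟦ t ⟧
    ⟦⟧-closed (node ps) = ⟦⟧ᶠ-closed ps

    ⟦⟧ᶠ-closed : ∀ ps → Closed ⟦ ps ⟧ᶠ
    ⟦⟧ᶠ-closed [] = 𝟎c
    ⟦⟧ᶠ-closed ((a , t) ∷ ps) = ⊕c (∙c (⟦⟧-closed t)) (⟦⟧ᶠ-closed ps)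

  mutual
    ⟦⟧-bccsp : ∀ t → BCCSP ⟦ t ⟧
    ⟦⟧-bccsp (node ps) = ⟦⟧ᶠ-bccsp ps

    ⟦⟧ᶠ-bccsp : ∀ ps → BCCSP ⟦ ps ⟧ᶠ
    ⟦⟧ᶠ-bccsp [] = 𝟎b
    ⟦⟧ᶠ-bccsp ((a , t) ∷ ps) = ⊕b (∙b (⟦⟧-bccsp t)) (⟦⟧ᶠ-bccsp ps)

  weight-tail : ∀ p ps → weight ps < weight (p ∷ ps)
  weight-tail (a , t) ps = m<n+m (weight ps) z<s

  weight-skip : ∀ p q ps → weight (p ∷ ps) < weight (p ∷ q ∷ ps)
  weight-skip (a , t) q ps = +-monoʳ-< (suc (size t)) (weight-tail q ps)

  weight-↭ : ∀ {ps qs} → ps ↭ qs → weight ps ≡ weight qs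
  weight-↭ refl = ≡.refl
  weight-↭ (prep (a , t) π) = ≡.cong (suc (size t) +_) (weight-↭ π)
  weight-↭ (swap (a , t) (b , u) π) =
    ≡.trans (x∙yz≈y∙xz (suc (size t)) (suc (size u)) _)
            (≡.cong (λ w → suc (size u) + (suc (size t) + w)) (weight-↭ π))
  weight-↭ (trans π ρ) = ≡.trans (weight-↭ π) (weight-↭ ρ)

  ∈⇒size< : ∀ {a t ps} → (a , t) ∈ ps → size t < weight ps
  ∈⇒size< {t = t} {ps = _ ∷ ps} (here ≡.refl) = s≤s (m≤m+n (size t) (weight ps))
  ∈⇒size< {ps = p ∷ ps} (there t∈ps) = <-trans (∈⇒size< t∈ps) (weight-tail p ps)

  ∈⇒size≤ : ∀ {a t ps k} → (a , t) ∈ ps → weight ps ≤ suc k → size t ≤ k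
  ∈⇒size≤ t∈ps bound = s≤s⁻¹ (<-≤-trans (∈⇒size< t∈ps) bound)

  ↭⇒weight≤ : ∀ {ps p q rest k} → ps ↭ p ∷ q ∷ rest → weight ps ≤ suc k →
              weight (p ∷ rest) ≤ k × weight (q ∷ rest) ≤ k
  ↭⇒weight≤ {p = p} {q} {rest} π bound =
    s≤s⁻¹ (<-≤-trans (weight-skip p q rest) bound′) ,
    s≤s⁻¹ (<-≤-trans (weight-tail p (q ∷ rest)) bound′)
    where bound′ = ≡.subst (_≤ _) (weight-↭ π) bound

module Normalisation {A : Set} (_≟_ : DecidableEquality A) (E : EqSet A)
  (E₁⇒E : E₁ ⇒ E) (FP⇒E : FPax ⇒ E) (EL2⇒E : EL2ax ⇒ E) where
  open Trees {A}
  open Duplicates {A} {Tree} _≟_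

  infix 4 _≈_
  _≈_ : Term A → Term A → Set
  t ≈ u = E ⊢ t ≈ u

  setoid : Setoid _ _
  setoid = record
    { Carrier = Term A ; _≈_ = _≈_
    ; isEquivalence = record { refl = refl ; sym = sym ; trans = trans } }
  open import Relation.Binary.Reasoning.Setoid setoid

  ⊕-identityʳ : ∀ t → t ⊕ 𝟎 ≈ t
  ⊕-identityʳ t = ax (E₁⇒E (A0 t))

  ⊕-comm : ∀ t u → t ⊕ u ≈ u ⊕ t
  ⊕-comm t u = ax (E₁⇒E (A1 t u))

  ⊕-assoc : ∀ t u v → (t ⊕ u) ⊕ v ≈ t ⊕ (u ⊕ v)
  ⊕-assoc t u v = ax (E₁⇒E (A2 t u v))

  ⊕-identityˡ : ∀ t → 𝟎 ⊕ t ≈ t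
  ⊕-identityˡ t = trans (⊕-comm 𝟎 t) (⊕-identityʳ t)

  ⊕-leftComm : ∀ t u v → t ⊕ (u ⊕ v) ≈ u ⊕ (t ⊕ v)
  ⊕-leftComm t u v = begin
    t ⊕ (u ⊕ v)  ≈⟨ sym (⊕-assoc t u v) ⟩
    (t ⊕ u) ⊕ v  ≈⟨ cong⊕ (⊕-comm t u) refl ⟩
    (u ⊕ t) ⊕ v  ≈⟨ ⊕-assoc u t v ⟩
    u ⊕ (t ⊕ v)  ∎

  ∥-identityʳ : ∀ t → t ∥ 𝟎 ≈ t
  ∥-identityʳ t = ax (E₁⇒E (P0 t))

  ∥-comm : ∀ t u → t ∥ u ≈ u ∥ t
  ∥-comm t u = ax (E₁⇒E (P1 t u))

  ∥-identityˡ : ∀ t → 𝟎 ∥ t ≈ t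
  ∥-identityˡ t = trans (∥-comm 𝟎 t) (∥-identityʳ t)

  Σ⊕-∷ : ∀ t ts → Σ⊕ (t ∷ ts) ≈ t ⊕ Σ⊕ ts
  Σ⊕-∷ t [] = sym (⊕-identityʳ t)
  Σ⊕-∷ t (u ∷ ts) = refl

  Σ⊕-cong : ∀ {B : Set} {φ ψ : B → Term A} → (∀ x → φ x ≈ ψ x) →
            ∀ xs → Σ⊕ (map φ xs) ≈ Σ⊕ (map ψ xs)
  Σ⊕-cong φ≈ψ [] = refl
  Σ⊕-cong {φ = φ} {ψ} φ≈ψ (x ∷ xs) = begin
    Σ⊕ (φ x ∷ map φ xs)   ≈⟨ Σ⊕-∷ (φ x) (map φ xs) ⟩
    φ x ⊕ Σ⊕ (map φ xs)   ≈⟨ cong⊕ (φ≈ψ x) (Σ⊕-cong φ≈ψ xs) ⟩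
    ψ x ⊕ Σ⊕ (map ψ xs)   ≈⟨ sym (Σ⊕-∷ (ψ x) (map ψ xs)) ⟩
    Σ⊕ (ψ x ∷ map ψ xs)   ∎

  ⟦++⟧ᶠ : ∀ ps qs → ⟦ ps ++ qs ⟧ᶠ ≈ ⟦ ps ⟧ᶠ ⊕ ⟦ qs ⟧ᶠ
  ⟦++⟧ᶠ [] qs = sym (⊕-identityˡ ⟦ qs ⟧ᶠ)
  ⟦++⟧ᶠ ((a , t) ∷ ps) qs =
    trans (cong⊕ refl (⟦++⟧ᶠ ps qs)) (sym (⊕-assoc (a ∙ ⟦ t ⟧) ⟦ ps ⟧ᶠ ⟦ qs ⟧ᶠ))

  ⟦⟧ᶠ-↭ : ∀ {ps qs} → ps ↭ qs → ⟦ ps ⟧ᶠ ≈ ⟦ qs ⟧ᶠ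
  ⟦⟧ᶠ-↭ refl = refl
  ⟦⟧ᶠ-↭ (prep _ π) = cong⊕ refl (⟦⟧ᶠ-↭ π)
  ⟦⟧ᶠ-↭ (swap (a , t) (b , u) π) = trans (⊕-leftComm _ _ _) (cong⊕ refl (cong⊕ refl (⟦⟧ᶠ-↭ π)))
  ⟦⟧ᶠ-↭ (trans π ρ) = trans (⟦⟧ᶠ-↭ π) (⟦⟧ᶠ-↭ ρ)

  Σpre-⟦⟧ : ∀ ps → Σpre (map (map₂ ⟦_⟧) ps) ≈ ⟦ ps ⟧ᶠ
  Σpre-⟦⟧ [] = refl
  Σpre-⟦⟧ ((a , t) ∷ []) = sym (⊕-identityʳ (a ∙ ⟦ t ⟧))
  Σpre-⟦⟧ ((a , t) ∷ q ∷ ps) = cong⊕ refl (Σpre-⟦⟧ (q ∷ ps))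

  fp-split : ∀ {ps a x y rest} z → ps ↭ (a , x) ∷ (a , y) ∷ rest →
             ⟦ ps ⟧ᶠ ∥ z ≈ ⟦ (a , x) ∷ rest ⟧ᶠ ∥ z ⊕ ⟦ (a , y) ∷ rest ⟧ᶠ ∥ z
  fp-split {ps} {a} {x} {y} {rest} z π = begin
    ⟦ ps ⟧ᶠ ∥ z                                   ≈⟨ cong∥ (⟦⟧ᶠ-↭ π) refl ⟩
    (a ∙ ⟦ x ⟧ ⊕ (a ∙ ⟦ y ⟧ ⊕ ⟦ rest ⟧ᶠ)) ∥ z      ≈⟨ cong∥ (sym (⊕-assoc _ _ _)) refl ⟩
    (a ∙ ⟦ x ⟧ ⊕ a ∙ ⟦ y ⟧ ⊕ ⟦ rest ⟧ᶠ) ∥ z        ≈⟨ ax (FP⇒E (fp a ⟦ x ⟧ ⟦ y ⟧ ⟦ rest ⟧ᶠ z)) ⟩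
    ⟦ (a , x) ∷ rest ⟧ᶠ ∥ z ⊕ ⟦ (a , y) ∷ rest ⟧ᶠ ∥ z ∎

  fp-splitʳ : ∀ {qs b u v rest} z → qs ↭ (b , u) ∷ (b , v) ∷ rest →
              z ∥ ⟦ qs ⟧ᶠ ≈ z ∥ ⟦ (b , u) ∷ rest ⟧ᶠ ⊕ z ∥ ⟦ (b , v) ∷ rest ⟧ᶠ
  fp-splitʳ z π =
    trans (∥-comm _ _) (trans (fp-split z π) (cong⊕ (∥-comm _ _) (∥-comm _ _)))

  moveˡ : Forest → A × Tree → Term A
  moveˡ qs (a , t) = a ∙ (⟦ t ⟧ ∥ ⟦ qs ⟧ᶠ)

  moveʳ : Forest → A × Tree → Term A
  moveʳ ps (b , u) = b ∙ (⟦ ps ⟧ᶠ ∥ ⟦ u ⟧)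

  expansion : ∀ {ps qs} → Unique (map proj₁ ps) → Unique (map proj₁ qs) →
    ⟦ ps ⟧ᶠ ∥ ⟦ qs ⟧ᶠ ≈ Σ⊕ (map (moveˡ qs) ps) ⊕ Σ⊕ (map (moveʳ ps) qs)
  expansion {ps} {qs} ps-unique qs-unique = begin
    ⟦ ps ⟧ᶠ ∥ ⟦ qs ⟧ᶠ
      ≈⟨ sym (cong∥ (Σpre-⟦⟧ ps) (Σpre-⟦⟧ qs)) ⟩
    Σpre ps′ ∥ Σpre qs′
      ≈⟨ ax (EL2⇒E (el2 ps′ qs′ (unique′ ps ps-unique) (unique′ qs qs-unique))) ⟩
    Σpre∥ʳ ps′ (Σpre qs′) ⊕ Σpre∥ˡ (Σpre ps′) qs′
      ≡⟨ ≡.cong₂ _⊕_ (≡.cong Σ⊕ (≡.sym (map-∘ ps))) (≡.cong Σ⊕ (≡.sym (map-∘ qs))) ⟩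
    Σ⊕ (map (λ (a , t) → a ∙ (⟦ t ⟧ ∥ Σpre qs′)) ps) ⊕ Σ⊕ (map (λ (b , u) → b ∙ (Σpre ps′ ∥ ⟦ u ⟧)) qs)
      ≈⟨ cong⊕ (Σ⊕-cong (λ _ → cong∙ (cong∥ refl (Σpre-⟦⟧ qs))) ps)
               (Σ⊕-cong (λ _ → cong∙ (cong∥ (Σpre-⟦⟧ ps) refl)) qs) ⟩
    Σ⊕ (map (moveˡ qs) ps) ⊕ Σ⊕ (map (moveʳ ps) qs) ∎
    where
    ps′ qs′ : List (A × Term A)
    ps′ = map (map₂ ⟦_⟧) ps
    qs′ = map (map₂ ⟦_⟧) qs
    unique′ : ∀ xs → Unique (map proj₁ xs) → Unique (map proj₁ (map (map₂ ⟦_⟧) xs))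
    unique′ xs = ≡.subst Unique (map-∘ xs)

  NormalForm : Term A → Set
  NormalForm t = Σ[ ps ∈ Forest ] t ≈ ⟦ ps ⟧ᶠ

  nf-resp : ∀ {t u} → t ≈ u → NormalForm u → NormalForm t
  nf-resp t≈u (ps , u≈ps) = ps , trans t≈u u≈ps

  nf-𝟎 : NormalForm 𝟎
  nf-𝟎 = [] , refl

  nf-∙ : ∀ {a t} → NormalForm t → NormalForm (a ∙ t)
  nf-∙ {a} (ps , t≈ps) = (a , node ps) ∷ [] , trans (cong∙ t≈ps) (sym (⊕-identityʳ _))

  nf-⊕ : ∀ {t u} → NormalForm t → NormalForm u → NormalForm (t ⊕ u)
  nf-⊕ (ps , t≈ps) (qs , u≈qs) = ps ++ qs , trans (cong⊕ t≈ps u≈qs) (sym (⟦++⟧ᶠ ps qs))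

  nf-Σ⊕ : ∀ {B : Set} (φ : B → Term A) xs → (∀ {x} → x ∈ xs → NormalForm (φ x)) →
          NormalForm (Σ⊕ (map φ xs))
  nf-Σ⊕ φ [] nf = nf-𝟎
  nf-Σ⊕ φ (x ∷ xs) nf =
    nf-resp (Σ⊕-∷ (φ x) (map φ xs)) (nf-⊕ (nf (here ≡.refl)) (nf-Σ⊕ φ xs (nf ∘ there)))

  -- Lexicographic recursion on bounds for the two weights: FP-splits and
  -- descents into the left operand lower the first, those on the right the second.
  parallel : ∀ kp kq ps qs → weight ps ≤ kp → weight qs ≤ kq → NormalForm (⟦ ps ⟧ᶠ ∥ ⟦ qs ⟧ᶠ)
  parallel _ _ [] qs _ _ = qs , ∥-identityˡ ⟦ qs ⟧ᶠ
  parallel _ _ ps@(_ ∷ _) [] _ _ = ps , ∥-identityʳ ⟦ ps ⟧ᶠ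
  parallel zero _ (_ ∷ _) (_ ∷ _) () _
  parallel (suc _) zero (_ ∷ _) (_ ∷ _) _ ()
  parallel (suc kp) (suc kq) ps@(_ ∷ _) qs@(_ ∷ _) ps≤ qs≤
    with uniqueKeys⊎duplicateKey ps | uniqueKeys⊎duplicateKey qs
  ... | inj₂ (duplicate a x y rest π) | _ =
    let x≤ , y≤ = ↭⇒weight≤ π ps≤ in
    nf-resp (fp-split ⟦ qs ⟧ᶠ π)
      (nf-⊕ (parallel kp (suc kq) ((a , x) ∷ rest) qs x≤ qs≤)
            (parallel kp (suc kq) ((a , y) ∷ rest) qs y≤ qs≤))
  ... | inj₁ _ | inj₂ (duplicate b u v rest π) =
    let u≤ , v≤ = ↭⇒weight≤ π qs≤ in
    nf-resp (fp-splitʳ ⟦ ps ⟧ᶠ π)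
      (nf-⊕ (parallel (suc kp) kq ps ((b , u) ∷ rest) ps≤ u≤)
            (parallel (suc kp) kq ps ((b , v) ∷ rest) ps≤ v≤))
  ... | inj₁ ps-unique | inj₁ qs-unique =
    nf-resp (expansion {ps} {qs} ps-unique qs-unique)
      (nf-⊕ (nf-Σ⊕ (moveˡ qs) ps descendˡ) (nf-Σ⊕ (moveʳ ps) qs descendʳ))
    where
    descendˡ : ∀ {p} → p ∈ ps → NormalForm (moveˡ qs p)
    descendˡ {a , node xs} x∈ps = nf-∙ (parallel kp (suc kq) xs qs (∈⇒size≤ x∈ps ps≤) qs≤)

    descendʳ : ∀ {q} → q ∈ qs → NormalForm (moveʳ ps q)
    descendʳ {b , node ys} y∈qs = nf-∙ (parallel (suc kp) kq ps ys ps≤ (∈⇒size≤ y∈qs qs≤))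

  normalise : ∀ {p} → Closed p → NormalForm p
  normalise 𝟎c = nf-𝟎
  normalise (∙c p) = nf-∙ (normalise p)
  normalise (⊕c p q) = nf-⊕ (normalise p) (normalise q)
  normalise (∥c p q) with ps , p≈ps ← normalise p | qs , q≈qs ← normalise q =
    nf-resp (cong∥ p≈ps q≈qs) (parallel _ _ ps qs ≤-refl ≤-refl)

proposition5p6 : (n : ℕ) (X : Variant) (p : Term (Act n)) → Closed p →
    Σ (Term (Act n)) (λ q → Closed q × BCCSP q × (𝓔 X ⊢ p ≈ q))
proposition5p6 n X p p-closed =
  let ps , p≈ps = Normalisation.normalise Fin._≟_ (𝓔 X) e1 fpX elX p-closed
  in ⟦ ps ⟧ᶠ , ⟦⟧ᶠ-closed ps , ⟦⟧ᶠ-bccsp ps , p≈ps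
  where open Trees
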